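{- Let $p<q$ be primes, let $\mathcal{A}=\{ -1,0,1\}$, let $\boldsymbol{d}_0=1(-1)0\cdots0\in\mathcal{A}^p$, $\boldsymbol{d}_i=\sigma^{iq}(\boldsymbol{d}_0)$ for $i\ge1$, and $\boldsymbol{\omega}_0=\boldsymbol{d}_0$, $\boldsymbol{\omega}_i=\boldsymbol{\omega}_{i-1}+\boldsymbol{d}_i$ for $i\ge1$ (coordinatewise addition in $\mathbb{Z}$). Then $\boldsymbol{\omega}_i\in\mathcal{A}^p$ for every $i\in\{0,1,\dots,p-2\}$.
   Context: The left circular permutation $\sigma:\mathcal{A}^p\to\mathcal{A}^p$ is $\sigma(v_0v_1\cdots v_{p-1})=v_1\cdots v_{p-1}v_0$. Words of length $p$ are identified with vectors in $\mathbb{Z}^p$ for the purpose of addition. -}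

module Defs where

open import Data.Nat using (ℕ; zero; suc)
open import Data.Nat.DivMod using (_%_; m%n<n)
open import Data.Fin using (Fin; toℕ; fromℕ<)
open import Data.Integer using (ℤ; +_; -[1+_]; _+_)
open import Data.Product using (_×_)
open import Data.Sum using (_⊎_)
open import Relation.Binary.PropositionalEquality using (_≡_)

Word : ℕ → Set
Word p = Fin p → ℤ

next : ∀ {p} → Fin p → Fin p
next {suc n} j = fromℕ< (m%n<n (suc (toℕ j)) (suc n))

σ : ∀ {p} → Word p → Word p
σ v j = v (next j)

σ^ : ∀ {p} → ℕ → Word p → Word p
σ^ zero    v = v
σ^ (suc k) v = σ (σ^ k v)

InA : ℤ → Set
InA x = x ≡ -[1+ 0 ] ⊎ (x ≡ + 0 ⊎ x ≡ + 1)

InAp : ∀ {p} → Word p → Set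
InAp v = ∀ j → InA (v j)

d0 : ∀ {p} → Word p
d0 j with toℕ j
... | zero        = + 1
... | suc zero    = -[1+ 0 ]
... | suc (suc _) = + 0

d : ∀ {p} → ℕ → ℕ → Word p
d q i = σ^ (i Data.Nat.* q) d0

ω : ∀ {p} → ℕ → ℕ → Word p
ω q zero    = d0
ω q (suc i) = λ j → ω q i j + d q (suc i) j

-- Since d₀ = e₀ − e₁, the word σ^{kq}(d₀) has its 1 at position −kq and its −1 at
-- position 1 − kq (mod p).  Hence the letter of ωᵢ at position j is the number of
-- k ≤ i with j + kq ≡ 0 minus the number of k ≤ i with j + kq ≡ 1 (mod p).  As p is a
-- prime not dividing q, k ↦ j + kq (mod p) is injective on k < p, so for i ≤ p − 2
-- each of the two counts is 0 or 1 and their difference lies in {−1, 0, 1}.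
module Submission where

open import Defs
open import Data.Nat using (ℕ; _<_; _≤_; _+_)
open import Data.Nat.Primality using (Prime)

open import Data.Nat using (zero; suc; _*_; _∸_; _≟_; z≤n; s≤s; NonZero; NonTrivial; >-nonZero)
open import Data.Nat.Properties
open import Data.Nat.DivMod using (_%_; _/_; m%n<n; m%n%n≡m%n; %-distribˡ-+; m≡m%n+[m/n]*n; m<n⇒m%n≡m)
open import Data.Nat.Divisibility using (_∣_; _∤_; divides; >⇒∤)
open import Data.Nat.Primality using (euclidsLemma; composite; prime⇒¬composite; prime⇒nonTrivial)
open import Data.Fin using (Fin; toℕ; fromℕ<)
open import Data.Fin.Properties using (toℕ-fromℕ<; toℕ-injective; toℕ<n)
open import Data.Integer using (+_; _⊖_; -_)
  renaming (_+_ to _+ℤ_)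
import Data.Integer.Properties as ℤ
open import Algebra.Properties.CommutativeSemigroup ℤ.+-commutativeSemigroup using (interchange)
open import Data.Sum using (inj₁; inj₂)
open import Function using (_∘_; _$_)
open import Relation.Nullary using (yes; no; contradiction)
open import Relation.Binary.Definitions using (tri<; tri≈; tri>)
open import Relation.Binary.PropositionalEquality

δ : ℕ → ℕ → ℕ
δ m n with m ≟ n
... | yes _ = 1
... | no  _ = 0

δ-≢ : ∀ {m n} → m ≢ n → δ m n ≡ 0
δ-≢ {m} {n} m≢n with m ≟ n
... | yes m≡n = contradiction m≡n m≢n
... | no  _   = refl

δ≤1 : ∀ m n → δ m n ≤ 1
δ≤1 m n with m ≟ n
... | yes _ = s≤s z≤n
... | no  _ = z≤n

count : (ℕ → ℕ) → ℕ → ℕ → ℕ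
count f c zero    = δ (f zero) c
count f c (suc i) = count f c i + δ (f (suc i)) c

InjectiveUpTo : (ℕ → ℕ) → ℕ → Set
InjectiveUpTo f i = ∀ {k l} → k ≤ i → l ≤ i → f k ≡ f l → k ≡ l

count≡0 : ∀ f c i → (∀ {k} → k ≤ i → f k ≢ c) → count f c i ≡ 0
count≡0 f c zero    miss = δ-≢ (miss z≤n)
count≡0 f c (suc i) miss =
  cong₂ _+_ (count≡0 f c i (miss ∘ m≤n⇒m≤1+n)) (δ-≢ (miss ≤-refl))

injectiveUpTo⇒count≤1 : ∀ f c i → InjectiveUpTo f i → count f c i ≤ 1
injectiveUpTo⇒count≤1 f c zero    inj = δ≤1 (f zero) c
injectiveUpTo⇒count≤1 f c (suc i) inj with f (suc i) ≟ c
... | yes hit = subst (λ m → m + 1 ≤ 1) (sym none-before) ≤-refl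
  where
  none-before : count f c i ≡ 0
  none-before = count≡0 f c i λ k≤i fk≡c →
    <⇒≢ (s≤s k≤i) (inj (m≤n⇒m≤1+n k≤i) ≤-refl (trans fk≡c (sym hit)))
... | no _ = subst (_≤ 1) (sym (+-identityʳ (count f c i))) $
  injectiveUpTo⇒count≤1 f c i λ k≤i l≤i → inj (m≤n⇒m≤1+n k≤i) (m≤n⇒m≤1+n l≤i)

⊖-+-⊖ : ∀ a b c e → (a ⊖ b) +ℤ (c ⊖ e) ≡ (a + c) ⊖ (b + e)
⊖-+-⊖ a b c e = begin
  (a ⊖ b) +ℤ (c ⊖ e)                      ≡⟨ cong₂ _+ℤ_ (ℤ.m-n≡m⊖n a b) (ℤ.m-n≡m⊖n c e) ⟨
  (+ a +ℤ - + b) +ℤ (+ c +ℤ - + e)        ≡⟨ interchange (+ a) (- + b) (+ c) (- + e) ⟩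
  (+ a +ℤ + c) +ℤ (- + b +ℤ - + e)        ≡⟨ cong ((+ a +ℤ + c) +ℤ_) (ℤ.neg-distrib-+ (+ b) (+ e)) ⟨
  (+ a +ℤ + c) +ℤ - (+ b +ℤ + e)          ≡⟨ cong₂ (λ x y → x +ℤ - y) (ℤ.pos-+ a c) (ℤ.pos-+ b e) ⟨
  + (a + c) +ℤ - + (b + e)                ≡⟨ ℤ.m-n≡m⊖n (a + c) (b + e) ⟩
  (a + c) ⊖ (b + e)                       ∎
  where open ≡-Reasoning

⊖-∈𝒜 : ∀ {a b} → a ≤ 1 → b ≤ 1 → InA (a ⊖ b)
⊖-∈𝒜 z≤n       z≤n       = inj₂ (inj₁ refl)
⊖-∈𝒜 z≤n       (s≤s z≤n) = inj₁ refl
⊖-∈𝒜 (s≤s z≤n) z≤n       = inj₂ (inj₂ refl)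
⊖-∈𝒜 (s≤s z≤n) (s≤s z≤n) = inj₂ (inj₁ refl)

[m%n+o]%n≡[m+o]%n : ∀ m o n .{{_ : NonZero n}} → (m % n + o) % n ≡ (m + o) % n
[m%n+o]%n≡[m+o]%n m o n = begin
  (m % n + o) % n          ≡⟨ %-distribˡ-+ (m % n) o n ⟩
  (m % n % n + o % n) % n  ≡⟨ cong (λ x → (x + o % n) % n) (m%n%n≡m%n m n) ⟩
  (m % n + o % n) % n      ≡⟨ %-distribˡ-+ m o n ⟨
  (m + o) % n              ∎
  where open ≡-Reasoning

%≡%⇒∣∸ : ∀ m o n .{{_ : NonZero n}} → m % n ≡ o % n → n ∣ m ∸ o
%≡%⇒∣∸ m o n m%n≡o%n = divides (m / n ∸ o / n) $ begin
  m ∸ o                                      ≡⟨ cong₂ _∸_ (m≡m%n+[m/n]*n m n) (m≡m%n+[m/n]*n o n) ⟩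
  (m % n + m / n * n) ∸ (o % n + o / n * n)  ≡⟨ cong (λ x → (x + m / n * n) ∸ (o % n + o / n * n)) m%n≡o%n ⟩
  (o % n + m / n * n) ∸ (o % n + o / n * n)  ≡⟨ [m+n]∸[m+o]≡n∸o (o % n) (m / n * n) (o / n * n) ⟩
  m / n * n ∸ o / n * n                      ≡⟨ *-distribʳ-∸ n (m / n) (o / n) ⟨
  (m / n ∸ o / n) * n                        ∎
  where open ≡-Reasoning

module _ {n : ℕ} where

  infixl 6 _+ₘ_
  _+ₘ_ : Fin (suc n) → ℕ → Fin (suc n)
  j +ₘ k = fromℕ< (m%n<n (toℕ j + k) (suc n))

  +ₘ-identityʳ : ∀ (j : Fin (suc n)) → j +ₘ 0 ≡ j
  +ₘ-identityʳ j = toℕ-injective $ begin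
    toℕ (j +ₘ 0)         ≡⟨ toℕ-fromℕ< _ ⟩
    (toℕ j + 0) % suc n  ≡⟨ cong (_% suc n) (+-identityʳ (toℕ j)) ⟩
    toℕ j % suc n        ≡⟨ m<n⇒m%n≡m (toℕ<n j) ⟩
    toℕ j                ∎
    where open ≡-Reasoning

  next-+ₘ : ∀ (j : Fin (suc n)) k → next j +ₘ k ≡ j +ₘ suc k
  next-+ₘ j k = toℕ-injective $ begin
    toℕ (next j +ₘ k)                  ≡⟨ toℕ-fromℕ< _ ⟩
    (toℕ (next j) + k) % suc n         ≡⟨ cong (λ x → (x + k) % suc n) (toℕ-fromℕ< (m%n<n (suc (toℕ j)) (suc n))) ⟩
    (suc (toℕ j) % suc n + k) % suc n  ≡⟨ [m%n+o]%n≡[m+o]%n (suc (toℕ j)) k (suc n) ⟩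
    (suc (toℕ j) + k) % suc n          ≡⟨ cong (_% suc n) (+-suc (toℕ j) k) ⟨
    (toℕ j + suc k) % suc n            ≡⟨ toℕ-fromℕ< _ ⟨
    toℕ (j +ₘ suc k)                   ∎
    where open ≡-Reasoning

  σ^-apply : ∀ k (v : Word (suc n)) j → σ^ k v j ≡ v (j +ₘ k)
  σ^-apply zero    v j = cong v (sym (+ₘ-identityʳ j))
  σ^-apply (suc k) v j = trans (σ^-apply k v (next j)) (cong v (next-+ₘ j k))

d0≡δ⊖δ : ∀ {p} (j : Fin p) → d0 j ≡ δ (toℕ j) 0 ⊖ δ (toℕ j) 1
d0≡δ⊖δ j with toℕ j
... | zero        = refl
... | suc zero    = refl
... | suc (suc _) = refl

module _ {n : ℕ} (q : ℕ) (j : Fin (suc n)) where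

  orbit : ℕ → ℕ
  orbit k = toℕ (j +ₘ k * q)

  d≡δ⊖δ : ∀ k → d q k j ≡ δ (orbit k) 0 ⊖ δ (orbit k) 1
  d≡δ⊖δ k = trans (σ^-apply (k * q) d0 j) (d0≡δ⊖δ (j +ₘ k * q))

  ω≡count⊖count : ∀ i → ω q i j ≡ count orbit 0 i ⊖ count orbit 1 i
  ω≡count⊖count zero    = d≡δ⊖δ zero
  ω≡count⊖count (suc i) = begin
    ω q i j +ℤ d q (suc i) j
      ≡⟨ cong₂ _+ℤ_ (ω≡count⊖count i) (d≡δ⊖δ (suc i)) ⟩
    (count orbit 0 i ⊖ count orbit 1 i) +ℤ (δ (orbit (suc i)) 0 ⊖ δ (orbit (suc i)) 1)
      ≡⟨ ⊖-+-⊖ (count orbit 0 i) (count orbit 1 i) (δ (orbit (suc i)) 0) (δ (orbit (suc i)) 1) ⟩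
    count orbit 0 (suc i) ⊖ count orbit 1 (suc i)
      ∎
    where open ≡-Reasoning

  orbit≡⇒∣ : ∀ k l → orbit k ≡ orbit l → suc n ∣ (l ∸ k) * q
  orbit≡⇒∣ k l orbit-k≡orbit-l = subst (suc n ∣_) difference (%≡%⇒∣∸ (t + l * q) (t + k * q) (suc n) residues)
    where
    t : ℕ
    t = toℕ j
    residues : (t + l * q) % suc n ≡ (t + k * q) % suc n
    residues = trans (sym (toℕ-fromℕ< _)) (trans (sym orbit-k≡orbit-l) (toℕ-fromℕ< _))
    difference : (t + l * q) ∸ (t + k * q) ≡ (l ∸ k) * q
    difference = trans ([m+n]∸[m+o]≡n∸o t (l * q) (k * q)) (sym (*-distribʳ-∸ q l k))

  module _ (p-prime : Prime (suc n)) (p∤q : suc n ∤ q) where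

    orbit-<⇒≢ : ∀ {k l} → k < l → l < suc n → orbit k ≢ orbit l
    orbit-<⇒≢ {k} {l} k<l l<p orbit-k≡orbit-l with euclidsLemma (l ∸ k) q p-prime (orbit≡⇒∣ k l orbit-k≡orbit-l)
    ... | inj₁ p∣l∸k = >⇒∤ {{>-nonZero (m<n⇒0<n∸m k<l)}} (≤-<-trans (m∸n≤m l k) l<p) p∣l∸k
    ... | inj₂ p∣q   = p∤q p∣q

    orbit-injective : ∀ {k l} → k < suc n → l < suc n → orbit k ≡ orbit l → k ≡ l
    orbit-injective {k} {l} k<p l<p orbit-k≡orbit-l with <-cmp k l
    ... | tri< k<l _ _ = contradiction orbit-k≡orbit-l (orbit-<⇒≢ k<l l<p)
    ... | tri≈ _ k≡l _ = k≡l
    ... | tri> _ _ l<k = contradiction (sym orbit-k≡orbit-l) (orbit-<⇒≢ l<k k<p)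

lemma1 : (p q : ℕ) → Prime p → Prime q → p < q →
    (i : ℕ) → i + 2 ≤ p → InAp {p} (ω q i)
lemma1 zero    q _       _       _   i _      ()
lemma1 (suc n) q p-prime q-prime p<q i i+2≤p j =
  subst InA (sym (ω≡count⊖count q j i))
    (⊖-∈𝒜 (injectiveUpTo⇒count≤1 (orbit q j) 0 i injective)
          (injectiveUpTo⇒count≤1 (orbit q j) 1 i injective))
  where
  instance
    p-nonTrivial : NonTrivial (suc n)
    p-nonTrivial = prime⇒nonTrivial p-prime
  p∤q : suc n ∤ q
  p∤q p∣q = prime⇒¬composite q-prime (composite p<q p∣q)
  i<p : i < suc n
  i<p = <-≤-trans (m<m+n i (s≤s z≤n)) i+2≤p
  injective : InjectiveUpTo (orbit q j) i
  injective k≤i l≤i = orbit-injective q j p-prime p∤q (≤-<-trans k≤i i<p) (≤-<-trans l≤i i<p)
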